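{- For integers $N,t\ge 0$ with $N\ge 2t$, let \[ F(N,t)=\binom{N}{\lceil N/2\rceil+t}\sum_{i=0}^{t}\binom{N}{\lceil N/2\rceil+i}^{ -1}. \] Then $F(N,t)\le 1+\min\{t, N/t\}$ (where $N/t$ is interpreted as $+\infty$ when $t=0$). -}

module Defs where

open import Data.Nat as ℕ using (ℕ; zero; suc; ⌈_/2⌉)
open import Data.Nat.Combinatorics using (_C_)
open import Data.Integer using (+_)
open import Data.Rational using (ℚ; _/_; _+_; _*_; 0ℚ)

-- reciprocal of a natural number as a rational; the value at 0 is an
-- arbitrary convention (never used: all binomials in F are positive when N ≥ 2t)
recipℕ : ℕ → ℚ
recipℕ zero    = 0ℚ
recipℕ (suc m) = + 1 / suc m

ℕtoℚ : ℕ → ℚ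
ℕtoℚ n = + n / 1

sumRecip : ℕ → ℕ → ℚ
sumRecip N zero    = recipℕ (N C ⌈ N /2⌉)
sumRecip N (suc t) = sumRecip N t + recipℕ (N C (⌈ N /2⌉ ℕ.+ suc t))

F : ℕ → ℕ → ℚ
F N t = ℕtoℚ (N C (⌈ N /2⌉ ℕ.+ t)) * sumRecip N t

-- With k = ⌈N/2⌉ + t, the ratio N C (k+1) / N C k = (N − k)/(k + 1) gives the
-- recurrence (k + 1)·F(N, t+1) = (N − k)·F(N, t) + (k + 1), with F(N, 0) = 1.
-- Both bounds F ≤ 1 + t and t·F ≤ t + N then propagate by induction on t: the
-- first because N − k ≤ k + 1; the second from the first when t² ≤ N, and from
-- itself when N ≤ t².
module Submission where

open import Defs
open import Data.Nat as ℕ using (ℕ; zero; suc; _∸_; _!; ⌊_/2⌋; ⌈_/2⌉; NonZero)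
import Data.Nat.Properties as ℕ
open import Data.Nat.Combinatorics using (_C_; nCk≡n!/k![n-k]!; k![n∸k]!∣n!; [n-k]*[n-k-1]!≡[n-k]!)
open import Data.Nat.DivMod using (m/n*n≡m)
open import Data.Nat.Tactic.RingSolver using (solve-∀)
open import Data.Integer as ℤ using (+_; 1ℤ)
import Data.Integer.Properties as ℤ
import Data.Integer.Solver as ℤ-Solver
open import Data.Rational as ℚ using (ℚ; _+_; _*_; _≤_; 0ℚ; 1ℚ; _/_; toℚᵘ; Positive; NonNegative)
import Data.Rational.Properties as ℚ
import Data.Rational.Solver as ℚ-Solver
open import Data.Rational.Unnormalised as ℚᵘ using (mkℚᵘ; *≡*)
import Data.Rational.Unnormalised.Properties as ℚᵘ
open import Data.Product using (_×_; _,_; proj₁; proj₂)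
open import Relation.Nullary using (yes; no)
open import Relation.Binary.PropositionalEquality


nCk*k![n∸k]!≡n! : ∀ {n k} → k ℕ.≤ n → (n C k) ℕ.* (k ! ℕ.* (n ∸ k) !) ≡ n !
nCk*k![n∸k]!≡n! {n} {k} k≤n =
  trans (cong (ℕ._* (k ! ℕ.* (n ∸ k) !)) (nCk≡n!/k![n-k]! k≤n))
        (m/n*n≡m {{k ℕ.!* (n ∸ k) !≢0}} (k![n∸k]!∣n! k≤n))

nCk≢0 : ∀ {n k} → k ℕ.≤ n → NonZero (n C k)
nCk≢0 {n} {k} k≤n =
  ℕ.m*n≢0⇒m≢0 (n C k) {{subst NonZero (sym (nCk*k![n∸k]!≡n! k≤n)) (n ℕ.!≢0)}}

nC[1+k]*[1+k]≡nCk*[n∸k] : ∀ {n k} → k ℕ.< n → (n C suc k) ℕ.* suc k ≡ (n C k) ℕ.* (n ∸ k)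
nC[1+k]*[1+k]≡nCk*[n∸k] {n} {k} k<n =
  ℕ.*-cancelʳ-≡ _ _ (k ! ℕ.* (n ∸ suc k) !) {{k ℕ.!* (n ∸ suc k) !≢0}} (begin
    (n C suc k) ℕ.* suc k ℕ.* (k ! ℕ.* (n ∸ suc k) !)    ≡⟨ regroupˡ (n C suc k) (suc k) (k !) ((n ∸ suc k) !) ⟩
    (n C suc k) ℕ.* (suc k ! ℕ.* (n ∸ suc k) !)          ≡⟨ nCk*k![n∸k]!≡n! k<n ⟩
    n !                                                 ≡⟨ nCk*k![n∸k]!≡n! (ℕ.<⇒≤ k<n) ⟨
    (n C k) ℕ.* (k ! ℕ.* (n ∸ k) !)                       ≡⟨ cong (λ m → (n C k) ℕ.* (k ! ℕ.* m)) ([n-k]*[n-k-1]!≡[n-k]! k<n) ⟨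
    (n C k) ℕ.* (k ! ℕ.* ((n ∸ k) ℕ.* (n ∸ suc k) !))     ≡⟨ regroupʳ (n C k) (n ∸ k) (k !) ((n ∸ suc k) !) ⟨
    (n C k) ℕ.* (n ∸ k) ℕ.* (k ! ℕ.* (n ∸ suc k) !)      ∎)
  where
  open ≡-Reasoning
  regroupˡ : ∀ b m f g → b ℕ.* m ℕ.* (f ℕ.* g) ≡ b ℕ.* (m ℕ.* f ℕ.* g)
  regroupˡ = solve-∀
  regroupʳ : ∀ b m f g → b ℕ.* m ℕ.* (f ℕ.* g) ≡ b ℕ.* (f ℕ.* (m ℕ.* g))
  regroupʳ = solve-∀


⌊n+n/2⌋≡n : ∀ n → ⌊ n ℕ.+ n /2⌋ ≡ n
⌊n+n/2⌋≡n zero    = refl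
⌊n+n/2⌋≡n (suc n) = trans (cong (λ m → ⌊ suc m /2⌋) (ℕ.+-suc n n)) (cong suc (⌊n+n/2⌋≡n n))

2*m≤n⇒m≤⌊n/2⌋ : ∀ {m n} → 2 ℕ.* m ℕ.≤ n → m ℕ.≤ ⌊ n /2⌋
2*m≤n⇒m≤⌊n/2⌋ {m} {n} 2m≤n = subst (ℕ._≤ ⌊ n /2⌋) (⌊n+n/2⌋≡n m)
  (ℕ.⌊n/2⌋-mono (subst (λ j → m ℕ.+ j ℕ.≤ n) (ℕ.+-identityʳ m) 2m≤n))

n≤⌈n/2⌉+⌈n/2⌉ : ∀ n → n ℕ.≤ ⌈ n /2⌉ ℕ.+ ⌈ n /2⌉
n≤⌈n/2⌉+⌈n/2⌉ n = subst (ℕ._≤ ⌈ n /2⌉ ℕ.+ ⌈ n /2⌉) (ℕ.⌊n/2⌋+⌈n/2⌉≡n n)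
  (ℕ.+-monoˡ-≤ ⌈ n /2⌉ (ℕ.⌊n/2⌋≤⌈n/2⌉ n))

2*m≤n⇒⌈n/2⌉+m≤n : ∀ {m n} → 2 ℕ.* m ℕ.≤ n → ⌈ n /2⌉ ℕ.+ m ℕ.≤ n
2*m≤n⇒⌈n/2⌉+m≤n {m} {n} 2m≤n = begin
  ⌈ n /2⌉ ℕ.+ m         ≤⟨ ℕ.+-monoʳ-≤ ⌈ n /2⌉ (2*m≤n⇒m≤⌊n/2⌋ 2m≤n) ⟩
  ⌈ n /2⌉ ℕ.+ ⌊ n /2⌋   ≡⟨ ℕ.+-comm ⌈ n /2⌉ ⌊ n /2⌋ ⟩
  ⌊ n /2⌋ ℕ.+ ⌈ n /2⌉   ≡⟨ ℕ.⌊n/2⌋+⌈n/2⌉≡n n ⟩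
  n                     ∎
  where open ℕ.≤-Reasoning

complement+2*t≤ : ∀ {N c t} → N ℕ.≤ c ℕ.+ c → c ℕ.+ t ℕ.≤ N → N ∸ (c ℕ.+ t) ℕ.+ 2 ℕ.* t ℕ.≤ c ℕ.+ t
complement+2*t≤ {N} {c} {t} N≤2c c+t≤N = ℕ.+-cancelʳ-≤ c _ _ (begin
  N ∸ (c ℕ.+ t) ℕ.+ 2 ℕ.* t ℕ.+ c     ≡⟨ regroup (N ∸ (c ℕ.+ t)) c t ⟩
  N ∸ (c ℕ.+ t) ℕ.+ (c ℕ.+ t) ℕ.+ t   ≡⟨ cong (ℕ._+ t) (ℕ.m∸n+n≡m c+t≤N) ⟩
  N ℕ.+ t                              ≤⟨ ℕ.+-monoˡ-≤ t N≤2c ⟩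
  c ℕ.+ c ℕ.+ t                        ≡⟨ ℕ.+-assoc c c t ⟩
  c ℕ.+ (c ℕ.+ t)                      ≡⟨ ℕ.+-comm c (c ℕ.+ t) ⟩
  c ℕ.+ t ℕ.+ c                        ∎)
  where
  open ℕ.≤-Reasoning
  regroup : ∀ a c t → a ℕ.+ 2 ℕ.* t ℕ.+ c ≡ a ℕ.+ (c ℕ.+ t) ℕ.+ t
  regroup = solve-∀


bound-when-t²≤N : ∀ {a d t N} → a ℕ.≤ N → t ℕ.* t ℕ.≤ N → a ℕ.+ 2 ℕ.* t ℕ.< d →
                  suc t ℕ.* (a ℕ.* suc t) ℕ.≤ d ℕ.* N
bound-when-t²≤N {a} {d} {t} {N} a≤N t²≤N a+2t<d = begin
  suc t ℕ.* (a ℕ.* suc t)                ≡⟨ expand a t ⟩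
  a ℕ.* (t ℕ.* t) ℕ.+ a ℕ.* suc (2 ℕ.* t)  ≤⟨ ℕ.+-mono-≤ (ℕ.*-monoʳ-≤ a t²≤N) (ℕ.*-monoˡ-≤ (suc (2 ℕ.* t)) a≤N) ⟩
  a ℕ.* N ℕ.+ N ℕ.* suc (2 ℕ.* t)        ≡⟨ collect a t N ⟩
  suc (a ℕ.+ 2 ℕ.* t) ℕ.* N              ≤⟨ ℕ.*-monoˡ-≤ N a+2t<d ⟩
  d ℕ.* N                                ∎
  where
  open ℕ.≤-Reasoning
  expand : ∀ a t → suc t ℕ.* (a ℕ.* suc t) ≡ a ℕ.* (t ℕ.* t) ℕ.+ a ℕ.* suc (2 ℕ.* t)
  expand = solve-∀
  collect : ∀ a t N → a ℕ.* N ℕ.+ N ℕ.* suc (2 ℕ.* t) ≡ suc (a ℕ.+ 2 ℕ.* t) ℕ.* N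
  collect = solve-∀

bound-when-N≤t² : ∀ {a d t N} → a ℕ.≤ N → N ℕ.≤ t ℕ.* t → a ℕ.+ 2 ℕ.* t ℕ.< d →
                  suc t ℕ.* (a ℕ.* (t ℕ.+ N)) ℕ.≤ t ℕ.* (d ℕ.* N)
bound-when-N≤t² {a} {d} {t} {N} a≤N N≤t² a+2t<d = begin
  suc t ℕ.* (a ℕ.* (t ℕ.+ N))                                       ≡⟨ expand a t N ⟩
  a ℕ.* (t ℕ.* t) ℕ.+ a ℕ.* t ℕ.+ a ℕ.* N ℕ.+ t ℕ.* (a ℕ.* N)       ≤⟨ ℕ.+-monoˡ-≤ (t ℕ.* (a ℕ.* N)) small-terms ⟩
  N ℕ.* (t ℕ.* t) ℕ.+ N ℕ.* t ℕ.+ t ℕ.* t ℕ.* N ℕ.+ t ℕ.* (a ℕ.* N) ≡⟨ collect a t N ⟩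
  t ℕ.* (suc (a ℕ.+ 2 ℕ.* t) ℕ.* N)                                 ≤⟨ ℕ.*-monoʳ-≤ t (ℕ.*-monoˡ-≤ N a+2t<d) ⟩
  t ℕ.* (d ℕ.* N)                                                   ∎
  where
  open ℕ.≤-Reasoning
  small-terms : a ℕ.* (t ℕ.* t) ℕ.+ a ℕ.* t ℕ.+ a ℕ.* N ℕ.≤ N ℕ.* (t ℕ.* t) ℕ.+ N ℕ.* t ℕ.+ t ℕ.* t ℕ.* N
  small-terms = ℕ.+-mono-≤ (ℕ.+-mono-≤ (ℕ.*-monoˡ-≤ (t ℕ.* t) a≤N) (ℕ.*-monoˡ-≤ t a≤N))
                           (ℕ.*-monoˡ-≤ N (ℕ.≤-trans a≤N N≤t²))
  expand : ∀ a t N → suc t ℕ.* (a ℕ.* (t ℕ.+ N)) ≡ a ℕ.* (t ℕ.* t) ℕ.+ a ℕ.* t ℕ.+ a ℕ.* N ℕ.+ t ℕ.* (a ℕ.* N)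
  expand = solve-∀
  collect : ∀ a t N → N ℕ.* (t ℕ.* t) ℕ.+ N ℕ.* t ℕ.+ t ℕ.* t ℕ.* N ℕ.+ t ℕ.* (a ℕ.* N) ≡ t ℕ.* (suc (a ℕ.+ 2 ℕ.* t) ℕ.* N)
  collect = solve-∀


private
  toℚᵘ-ℕtoℚ : ∀ n → toℚᵘ (ℕtoℚ n) ℚᵘ.≃ mkℚᵘ (+ n) 0
  toℚᵘ-ℕtoℚ n = ℚ.toℚᵘ-fromℚᵘ (mkℚᵘ (+ n) 0)

ℕtoℚ-+ : ∀ m n → ℕtoℚ (m ℕ.+ n) ≡ ℕtoℚ m + ℕtoℚ n
ℕtoℚ-+ m n = ℚ.toℚᵘ-injective (begin
  toℚᵘ (ℕtoℚ (m ℕ.+ n))                 ≈⟨ toℚᵘ-ℕtoℚ (m ℕ.+ n) ⟩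
  mkℚᵘ (+ (m ℕ.+ n)) 0                   ≈⟨ *≡* (trans (cong (ℤ._* 1ℤ) (ℤ.pos-+ m n)) (cross-multiply (+ m) (+ n))) ⟩
  mkℚᵘ (+ m) 0 ℚᵘ.+ mkℚᵘ (+ n) 0         ≈⟨ ℚᵘ.+-cong (toℚᵘ-ℕtoℚ m) (toℚᵘ-ℕtoℚ n) ⟨
  toℚᵘ (ℕtoℚ m) ℚᵘ.+ toℚᵘ (ℕtoℚ n)      ≈⟨ ℚ.toℚᵘ-homo-+ (ℕtoℚ m) (ℕtoℚ n) ⟨
  toℚᵘ (ℕtoℚ m + ℕtoℚ n)                 ∎)
  where
  open ℚᵘ.≃-Reasoning
  open ℤ-Solver.+-*-Solver
  cross-multiply : ∀ x y → (x ℤ.+ y) ℤ.* 1ℤ ≡ (x ℤ.* 1ℤ ℤ.+ y ℤ.* 1ℤ) ℤ.* 1ℤ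
  cross-multiply = solve 2 (λ x y → (x :+ y) :* con 1ℤ := (x :* con 1ℤ :+ y :* con 1ℤ) :* con 1ℤ) refl

ℕtoℚ-* : ∀ m n → ℕtoℚ (m ℕ.* n) ≡ ℕtoℚ m * ℕtoℚ n
ℕtoℚ-* m n = ℚ.toℚᵘ-injective (begin
  toℚᵘ (ℕtoℚ (m ℕ.* n))                 ≈⟨ toℚᵘ-ℕtoℚ (m ℕ.* n) ⟩
  mkℚᵘ (+ (m ℕ.* n)) 0                   ≈⟨ *≡* (cong (ℤ._* 1ℤ) (ℤ.pos-* m n)) ⟩
  mkℚᵘ (+ m) 0 ℚᵘ.* mkℚᵘ (+ n) 0         ≈⟨ ℚᵘ.*-cong (toℚᵘ-ℕtoℚ m) (toℚᵘ-ℕtoℚ n) ⟨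
  toℚᵘ (ℕtoℚ m) ℚᵘ.* toℚᵘ (ℕtoℚ n)      ≈⟨ ℚ.toℚᵘ-homo-* (ℕtoℚ m) (ℕtoℚ n) ⟨
  toℚᵘ (ℕtoℚ m * ℕtoℚ n)                 ∎)
  where open ℚᵘ.≃-Reasoning

ℕtoℚ-*-/ : ∀ n d .{{_ : NonZero d}} → ℕtoℚ d * (+ n / d) ≡ ℕtoℚ n
ℕtoℚ-*-/ n (suc k) = ℚ.toℚᵘ-injective (begin
  toℚᵘ (ℕtoℚ (suc k) * (+ n / suc k))            ≈⟨ ℚ.toℚᵘ-homo-* (ℕtoℚ (suc k)) (+ n / suc k) ⟩
  toℚᵘ (ℕtoℚ (suc k)) ℚᵘ.* toℚᵘ (+ n / suc k)   ≈⟨ ℚᵘ.*-cong (toℚᵘ-ℕtoℚ (suc k)) (ℚ.toℚᵘ-fromℚᵘ (mkℚᵘ (+ n) k)) ⟩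
  mkℚᵘ (+ suc k) 0 ℚᵘ.* mkℚᵘ (+ n) k              ≈⟨ *≡* cross-multiply ⟩
  mkℚᵘ (+ n) 0                                     ≈⟨ toℚᵘ-ℕtoℚ n ⟨
  toℚᵘ (ℕtoℚ n)                                    ∎)
  where
  open ℚᵘ.≃-Reasoning
  cross-multiply : + suc k ℤ.* + n ℤ.* 1ℤ ≡ + n ℤ.* + (1 ℕ.* suc k)
  cross-multiply = trans (ℤ.*-identityʳ _) (trans (ℤ.*-comm (+ suc k) (+ n))
                     (cong (λ j → + n ℤ.* + j) (sym (ℕ.*-identityˡ (suc k)))))

ℕtoℚ-*-recipℕ : ∀ n .{{_ : NonZero n}} → ℕtoℚ n * recipℕ n ≡ 1ℚ
ℕtoℚ-*-recipℕ (suc k) = ℕtoℚ-*-/ 1 (suc k)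

ℕtoℚ-nonNeg : ∀ n → NonNegative (ℕtoℚ n)
ℕtoℚ-nonNeg n = ℚ.normalize-nonNeg n 1

ℕtoℚ-pos : ∀ n .{{_ : NonZero n}} → Positive (ℕtoℚ n)
ℕtoℚ-pos n = ℚ.normalize-pos n 1

ℕtoℚ-mono-≤ : ∀ {m n} → m ℕ.≤ n → ℕtoℚ m ≤ ℕtoℚ n
ℕtoℚ-mono-≤ {m} {n} m≤n = begin
  ℕtoℚ m                        ≡⟨ ℚ.+-identityʳ (ℕtoℚ m) ⟨
  ℕtoℚ m + 0ℚ                   ≤⟨ ℚ.+-monoʳ-≤ (ℕtoℚ m) (ℚ.nonNegative⁻¹ (ℕtoℚ (n ∸ m)) {{ℕtoℚ-nonNeg (n ∸ m)}}) ⟩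
  ℕtoℚ m + ℕtoℚ (n ∸ m)         ≡⟨ ℕtoℚ-+ m (n ∸ m) ⟨
  ℕtoℚ (m ℕ.+ (n ∸ m))          ≡⟨ cong ℕtoℚ (ℕ.m+[n∸m]≡n m≤n) ⟩
  ℕtoℚ n                        ∎
  where open ℚ.≤-Reasoning

private
  ι : ℕ → ℚ
  ι = ℕtoℚ

  ℕtoℚ-*-* : ∀ l m n → ℕtoℚ (l ℕ.* (m ℕ.* n)) ≡ ℕtoℚ l * (ℕtoℚ m * ℕtoℚ n)
  ℕtoℚ-*-* l m n = trans (ℕtoℚ-* l (m ℕ.* n)) (cong (ι l *_) (ℕtoℚ-* m n))


F-zero : ∀ N → F N 0 ≡ 1ℚ
F-zero N = trans (cong (λ j → ι (N C j) * recipℕ (N C ⌈ N /2⌉)) (ℕ.+-identityʳ ⌈ N /2⌉))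
                 (ℕtoℚ-*-recipℕ (N C ⌈ N /2⌉) {{nCk≢0 (ℕ.⌈n/2⌉≤n N)}})

F-suc : ∀ N t .{{_ : NonZero (N C (⌈ N /2⌉ ℕ.+ suc t))}} →
        F N (suc t) ≡ ℕtoℚ (N C (⌈ N /2⌉ ℕ.+ suc t)) * sumRecip N t + 1ℚ
F-suc N t = trans (ℚ.*-distribˡ-+ (ι b) (sumRecip N t) (recipℕ b))
                  (cong (λ q → ι b * sumRecip N t + q) (ℕtoℚ-*-recipℕ b))
  where b = N C (⌈ N /2⌉ ℕ.+ suc t)

F-recurrence : ∀ N t → ⌈ N /2⌉ ℕ.+ suc t ℕ.≤ N →
  let k = ⌈ N /2⌉ ℕ.+ t in
  ℕtoℚ (suc k) * F N (suc t) ≡ ℕtoℚ (N ∸ k) * F N t + ℕtoℚ (suc k)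
F-recurrence N t c+1+t≤N = begin
  ι (suc k) * F N (suc t)                      ≡⟨ cong (ι (suc k) *_) (F-suc N t {{nCk≢0 c+1+t≤N}}) ⟩
  ι (suc k) * (ι b′ * S + 1ℚ)                  ≡⟨ solve 3 (λ d b s → d :* (b :* s :+ con 1ℚ) := b :* d :* s :+ d) refl (ι (suc k)) (ι b′) S ⟩
  ι b′ * ι (suc k) * S + ι (suc k)             ≡⟨ cong (λ q → q * S + ι (suc k)) (ℕtoℚ-* b′ (suc k)) ⟨
  ι (b′ ℕ.* suc k) * S + ι (suc k)             ≡⟨ cong (λ n → ι n * S + ι (suc k)) b′*[1+k]≡b*[N∸k] ⟩
  ι (b ℕ.* (N ∸ k)) * S + ι (suc k)            ≡⟨ cong (λ q → q * S + ι (suc k)) (ℕtoℚ-* b (N ∸ k)) ⟩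
  ι b * ι (N ∸ k) * S + ι (suc k)              ≡⟨ cong (λ q → q + ι (suc k)) (solve 3 (λ b a s → b :* a :* s := a :* (b :* s)) refl (ι b) (ι (N ∸ k)) S) ⟩
  ι (N ∸ k) * (ι b * S) + ι (suc k)            ∎
  where
  open ≡-Reasoning
  open ℚ-Solver.+-*-Solver
  k  = ⌈ N /2⌉ ℕ.+ t
  b  = N C k
  b′ = N C (⌈ N /2⌉ ℕ.+ suc t)
  S  = sumRecip N t
  b′*[1+k]≡b*[N∸k] : b′ ℕ.* suc k ≡ b ℕ.* (N ∸ k)
  b′*[1+k]≡b*[N∸k] = trans (cong (λ j → (N C j) ℕ.* suc k) (ℕ.+-suc ⌈ N /2⌉ t))
                           (nC[1+k]*[1+k]≡nCk*[n∸k] (subst (ℕ._≤ N) (ℕ.+-suc ⌈ N /2⌉ t) c+1+t≤N))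


module _ {a d : ℕ} .{{_ : NonZero d}} {x x′ : ℚ}
         (recurrence : ℕtoℚ d * x′ ≡ ℕtoℚ a * x + ℕtoℚ d) where

  recurrence-bound-t : ∀ {t} → a ℕ.≤ d → x ≤ ℕtoℚ (suc t) → x′ ≤ ℕtoℚ (suc (suc t))
  recurrence-bound-t {t} a≤d x≤s = ℚ.*-cancelˡ-≤-pos (ι d) {{ℕtoℚ-pos d}} (begin
    ι d * x′              ≡⟨ recurrence ⟩
    ι a * x + ι d         ≤⟨ ℚ.+-monoˡ-≤ (ι d) (ℚ.*-monoˡ-≤-nonNeg (ι a) {{ℕtoℚ-nonNeg a}} x≤s) ⟩
    ι a * ι s + ι d       ≡⟨ trans (ℕtoℚ-+ (a ℕ.* s) d) (cong (λ q → q + ι d) (ℕtoℚ-* a s)) ⟨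
    ι (a ℕ.* s ℕ.+ d)     ≤⟨ ℕtoℚ-mono-≤ (ℕ.+-monoˡ-≤ d (ℕ.*-monoˡ-≤ s a≤d)) ⟩
    ι (d ℕ.* s ℕ.+ d)     ≡⟨ cong ι (d*s+d≡d*[1+s] d s) ⟩
    ι (d ℕ.* suc s)       ≡⟨ ℕtoℚ-* d (suc s) ⟩
    ι d * ι (suc s)       ∎)
    where
    open ℚ.≤-Reasoning
    s = suc t
    d*s+d≡d*[1+s] : ∀ d s → d ℕ.* s ℕ.+ d ≡ d ℕ.* suc s
    d*s+d≡d*[1+s] = solve-∀

  recurrence-bound-N : ∀ {t N} → a ℕ.≤ N → a ℕ.+ 2 ℕ.* t ℕ.< d →
                       x ≤ ℕtoℚ (suc t) → ℕtoℚ t * x ≤ ℕtoℚ (t ℕ.+ N) → ℕtoℚ (suc t) * x′ ≤ ℕtoℚ (suc t ℕ.+ N)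
  recurrence-bound-N {t} {N} a≤N a+2t<d x≤s tx≤t+N = ℚ.*-cancelˡ-≤-pos (ι d) {{ℕtoℚ-pos d}} (begin
    ι d * (ι s * x′)              ≡⟨ solve 3 (λ d s y → d :* (s :* y) := s :* (d :* y)) refl (ι d) (ι s) x′ ⟩
    ι s * (ι d * x′)              ≡⟨ cong (ι s *_) recurrence ⟩
    ι s * (ι a * x + ι d)         ≡⟨ solve 4 (λ s a y d → s :* (a :* y :+ d) := s :* (a :* y) :+ d :* s) refl (ι s) (ι a) x (ι d) ⟩
    ι s * (ι a * x) + ι d * ι s   ≤⟨ ℚ.+-monoˡ-≤ (ι d * ι s) growth ⟩
    ι d * ι N + ι d * ι s         ≡⟨ solve 3 (λ d n s → d :* n :+ d :* s := d :* (s :+ n)) refl (ι d) (ι N) (ι s) ⟩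
    ι d * (ι s + ι N)             ≡⟨ cong (ι d *_) (ℕtoℚ-+ s N) ⟨
    ι d * ι (s ℕ.+ N)             ∎)
    where
    open ℚ.≤-Reasoning
    open ℚ-Solver.+-*-Solver
    s = suc t

    mono₂ : ∀ {y z} → y ≤ z → ι s * (ι a * y) ≤ ι s * (ι a * z)
    mono₂ y≤z = ℚ.*-monoˡ-≤-nonNeg (ι s) {{ℕtoℚ-nonNeg s}} (ℚ.*-monoˡ-≤-nonNeg (ι a) {{ℕtoℚ-nonNeg a}} y≤z)

    growth : ι s * (ι a * x) ≤ ι d * ι N
    growth with t ℕ.* t ℕ.≤? N
    ... | yes t²≤N = begin
      ι s * (ι a * x)              ≤⟨ mono₂ x≤s ⟩
      ι s * (ι a * ι s)            ≡⟨ ℕtoℚ-*-* s a s ⟨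
      ι (s ℕ.* (a ℕ.* s))          ≤⟨ ℕtoℚ-mono-≤ (bound-when-t²≤N a≤N t²≤N a+2t<d) ⟩
      ι (d ℕ.* N)                  ≡⟨ ℕtoℚ-* d N ⟩
      ι d * ι N                    ∎
    ... | no t²≰N = ℚ.*-cancelˡ-≤-pos (ι t) {{ℕtoℚ-pos t {{t≢0}}}} (begin
      ι t * (ι s * (ι a * x))      ≡⟨ solve 4 (λ t s a y → t :* (s :* (a :* y)) := s :* (a :* (t :* y))) refl (ι t) (ι s) (ι a) x ⟩
      ι s * (ι a * (ι t * x))      ≤⟨ mono₂ tx≤t+N ⟩
      ι s * (ι a * ι (t ℕ.+ N))    ≡⟨ ℕtoℚ-*-* s a (t ℕ.+ N) ⟨
      ι (s ℕ.* (a ℕ.* (t ℕ.+ N)))  ≤⟨ ℕtoℚ-mono-≤ (bound-when-N≤t² a≤N (ℕ.<⇒≤ N<t²) a+2t<d) ⟩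
      ι (t ℕ.* (d ℕ.* N))          ≡⟨ ℕtoℚ-*-* t d N ⟩
      ι t * (ι d * ι N)            ∎)
      where
      N<t² : N ℕ.< t ℕ.* t
      N<t² = ℕ.≰⇒> t²≰N
      t≢0 : NonZero t
      t≢0 = ℕ.m*n≢0⇒m≢0 t {{ℕ.>-nonZero (ℕ.≤-<-trans ℕ.z≤n N<t²)}}

F-bounds : ∀ N t → 2 ℕ.* t ℕ.≤ N → F N t ≤ ℕtoℚ (suc t) × ℕtoℚ t * F N t ≤ ℕtoℚ (t ℕ.+ N)
-- ℕtoℚ 0 and ℕtoℚ 1 compute to 0ℚ and 1ℚ, which the base case relies on.
F-bounds N zero _ = ℚ.≤-reflexive (F-zero N)
                  , ℚ.≤-trans (ℚ.≤-reflexive (ℚ.*-zeroˡ (F N 0))) (ℚ.nonNegative⁻¹ (ι N) {{ℕtoℚ-nonNeg N}})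
F-bounds N (suc t) 2[1+t]≤N =
    recurrence-bound-t recurrence {t = t} (ℕ.≤-trans (ℕ.m≤m+n a (2 ℕ.* t)) (ℕ.<⇒≤ a+2t<1+k)) (proj₁ IH)
  , recurrence-bound-N recurrence {t = t} (ℕ.m∸n≤m N k) a+2t<1+k (proj₁ IH) (proj₂ IH)
  where
  k = ⌈ N /2⌉ ℕ.+ t
  a = N ∸ k
  c+1+t≤N : ⌈ N /2⌉ ℕ.+ suc t ℕ.≤ N
  c+1+t≤N = 2*m≤n⇒⌈n/2⌉+m≤n 2[1+t]≤N
  recurrence : ℕtoℚ (suc k) * F N (suc t) ≡ ℕtoℚ a * F N t + ℕtoℚ (suc k)
  recurrence = F-recurrence N t c+1+t≤N
  a+2t<1+k : a ℕ.+ 2 ℕ.* t ℕ.< suc k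
  a+2t<1+k = ℕ.s≤s (complement+2*t≤ {N} {⌈ N /2⌉} {t} (n≤⌈n/2⌉+⌈n/2⌉ N)
                       (ℕ.≤-trans (ℕ.+-monoʳ-≤ ⌈ N /2⌉ (ℕ.n≤1+n t)) c+1+t≤N))
  IH : F N t ≤ ℕtoℚ (suc t) × ℕtoℚ t * F N t ≤ ℕtoℚ (t ℕ.+ N)
  IH = F-bounds N t (ℕ.≤-trans (ℕ.*-monoʳ-≤ 2 (ℕ.n≤1+n t)) 2[1+t]≤N)

claim3p2 : (N t : ℕ) → 2 ℕ.* t ℕ.≤ N →
    (F N t ≤ 1ℚ + ℕtoℚ t)
    × (.{{_ : NonZero t}} → F N t ≤ 1ℚ + (+ N / t))
claim3p2 N t 2t≤N = subst (F N t ≤_) (ℕtoℚ-+ 1 t) F≤1+t , F≤1+N/t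
  where
  F≤1+t : F N t ≤ ℕtoℚ (suc t)
  F≤1+t = proj₁ (F-bounds N t 2t≤N)
  tF≤t+N : ℕtoℚ t * F N t ≤ ℕtoℚ (t ℕ.+ N)
  tF≤t+N = proj₂ (F-bounds N t 2t≤N)
  F≤1+N/t : .{{_ : NonZero t}} → F N t ≤ 1ℚ + (+ N / t)
  F≤1+N/t = ℚ.*-cancelˡ-≤-pos (ι t) {{ℕtoℚ-pos t}} (begin
    ι t * F N t                     ≤⟨ tF≤t+N ⟩
    ι (t ℕ.+ N)                     ≡⟨ ℕtoℚ-+ t N ⟩
    ι t + ι N                       ≡⟨ cong₂ _+_ (ℚ.*-identityʳ (ι t)) (ℕtoℚ-*-/ N t) ⟨
    ι t * 1ℚ + ι t * (+ N / t)      ≡⟨ ℚ.*-distribˡ-+ (ι t) 1ℚ (+ N / t) ⟨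
    ι t * (1ℚ + (+ N / t))          ∎)
    where open ℚ.≤-Reasoning
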